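{- For integers $m\ge 4$ and $n\ge 10$, the complete bipartite graph $K_{m,n}$ belongs to $\mathcal{S}_3$.
   Context: $Z(G,\mathbb{Z}_3)$ is the set of $\beta:V(G)\to\mathbb{Z}_3$ with $\sum_v\beta(v)\equiv0\pmod 3$; a $\beta$-orientation is an orientation $D$ of $G$ with $d^+_D(v)-d^-_D(v)\equiv\beta(v)\pmod 3$ for all $v$; $\mathcal{S}_3$ is the family of graphs admitting a strongly-connected $\beta$-orientation for every $\beta\in Z(G,\mathbb{Z}_3)$. -}

module Defs where

open import Data.Nat using (ℕ)
open import Data.Integer using (ℤ; +_; _-_; _⊖_)
open import Data.Integer.Divisibility using () renaming (_∣_ to _∣ℤ_)
open import Data.Fin using (Fin; toℕ; _↑ˡ_; _↑ʳ_; remQuot)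
open import Data.Fin.Properties using (_≟_)
open import Data.List using (List; length; filter; map)
open import Data.Nat.ListAction using (sum)
open import Data.List.Base using () renaming (allFin to allFinL)
open import Data.Bool using (Bool; true; false)
open import Data.Product using (Σ; _×_; _,_; proj₁; proj₂)
open import Relation.Binary.PropositionalEquality using (_≡_)

ℤ₃ : Set
ℤ₃ = Fin 3

record Graph : Set where
  field
    V : ℕ
    E : ℕ
    ends : Fin E → Fin V × Fin V
open Graph public

-- An orientation: for each edge, true = directed from first end to second end,
-- false = directed from second end to first end.
Orientation : Graph → Set
Orientation G = Fin (E G) → Bool

tail : (G : Graph) → Orientation G → Fin (E G) → Fin (V G)
tail G D e with D e
... | true  = proj₁ (ends G e)
... | false = proj₂ (ends G e)

head : (G : Graph) → Orientation G → Fin (E G) → Fin (V G)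
head G D e with D e
... | true  = proj₂ (ends G e)
... | false = proj₁ (ends G e)

outdeg : (G : Graph) → Orientation G → Fin (V G) → ℕ
outdeg G D v = length (filter (λ e → tail G D e ≟ v) (allFinL (E G)))

indeg : (G : Graph) → Orientation G → Fin (V G) → ℕ
indeg G D v = length (filter (λ e → head G D e ≟ v) (allFinL (E G)))

ZeroSum : (G : Graph) → (Fin (V G) → ℤ₃) → Set
ZeroSum G β = + 3 ∣ℤ + sum (map (λ v → toℕ (β v)) (allFinL (V G)))

IsβOrientation : (G : Graph) → (Fin (V G) → ℤ₃) → Orientation G → Set
IsβOrientation G β D =
  ∀ v → + 3 ∣ℤ ((outdeg G D v ⊖ indeg G D v) - + toℕ (β v))

data Reach (G : Graph) (D : Orientation G) : Fin (V G) → Fin (V G) → Set where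
  here : ∀ {u} → Reach G D u u
  step : ∀ {u w} (e : Fin (E G)) → tail G D e ≡ u → Reach G D (head G D e) w → Reach G D u w

StronglyConnected : (G : Graph) → Orientation G → Set
StronglyConnected G D = ∀ u v → Reach G D u v

InS3 : Graph → Set
InS3 G = ∀ (β : Fin (V G) → ℤ₃) → ZeroSum G β →
  Σ (Orientation G) (λ D → IsβOrientation G β D × StronglyConnected G D)

-- complete bipartite graph K_{m,n}: vertices Fin (m + n) (first m on one side),
-- edges Fin (m * n), edge e ↔ (i , j) with i : Fin m, j : Fin n.
K : ℕ → ℕ → Graph
K m n = record
  { V = m Data.Nat.+ n
  ; E = m Data.Nat.* n
  ; ends = λ e → (proj₁ (remQuot {m} n e) ↑ˡ n) , (m ↑ʳ proj₂ (remQuot {m} n e))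
  }

module Submission where

-- We orient K m n by a
-- Boolean m × n matrix X: the edge between row i and column j points from the
-- row to the column iff X i j is true. X is an explicit gadget.
--  * Every row except row 0 contains a two-bit slot holding, in unary, the
--    residue that puts its out-degree in the class required by β.
--  * The core rows 0–3 put 1 + e j trues into column j, where the residue e j
--    is chosen to meet the β-condition at column j; in the slot columns row 0
--    carries the complement of the slot, so slots do not change column counts.
--  * Row 0 is left unconstrained: as Σ β ≡ 0 and Σ (d⁺ - d⁻) = 0, the
--    β-condition at one vertex follows from the condition at all the others.
--  * The core rows lie on a directed cycle, every column has a true and a false
--    core entry (as 1 ≤ 1 + e j ≤ 3), and every other row has a false entry in
--    column 2 and a true one in column 3; hence row 0 is a hub of a strongly
--    connected orientation.

open import Defs
open import Data.Nat using (ℕ; zero; suc; _+_; _*_; _≥_; _<_; s≤s)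
open import Data.Nat.Properties
  using (+-identityʳ; +-assoc; +-comm; +-suc; +-*-semiring; ≤-pred; 0≢1+n; m≤n⇒∃[o]m+o≡n)
open import Data.Nat.Divisibility using (_∣_; divides; ∣m+n∣m⇒∣n; ∣m∣n⇒∣m+n; ∣n⇒∣m*n; n∣m*n)
open import Data.Nat.DivMod using (_divMod_; DivMod)
open import Data.Nat.Tactic.RingSolver using (solve-∀)
import Data.Nat.ListAction as List
open import Data.Integer as ℤ using (_⊖_) renaming (_+_ to _+ℤ_; _-_ to _-ℤ_; _*_ to _*ℤ_)
open import Data.Integer.Properties using (pos-+; pos-*; m-n≡m⊖n)
open import Data.Integer.Divisibility using () renaming (_∣_ to _∣ℤ_)
open import Data.Integer.Divisibility.Signed
  using (∣ᵤ⇒∣; ∣⇒∣ᵤ; ∣m∣n⇒∣m-n; ∣m⇒∣m*n) renaming (_∣_ to _∣ˢ_; ∣-refl to ∣ˢ-refl)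
open import Data.Integer.Tactic.RingSolver using () renaming (solve-∀ to ℤ-solve-∀)
open import Data.Fin using (Fin; zero; suc; toℕ; _↑ˡ_; _↑ʳ_; combine; remQuot; punchIn; splitAt; join)
open import Data.Fin.Properties
  using ( _≟_; toℕ<n; punchInᵢ≢i; join-splitAt; splitAt-↑ˡ; splitAt-↑ʳ
        ; ↑ˡ-injective; ↑ʳ-injective; remQuot-combine)
open import Data.Fin.Patterns using (0F; 1F; 2F; 3F; 4F; 5F; 6F; 7F; 8F; 9F)
open import Data.Vec.Functional using (Vector; _++_; insertAt; _∷_; [])
open import Data.Vec.Functional.Properties using (lookup-++ˡ; lookup-++ʳ; insertAt-lookup; insertAt-punchIn)
open import Data.Bool using (Bool; true; false; not; _∧_; if_then_else_)
open import Data.Bool.Properties using (∧-identityʳ; ∧-zeroʳ; not-involutive)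
open import Data.List using (length; filter; tabulate)
open import Data.List.Properties using (map-tabulate)
open import Data.Product using (Σ; _×_; _,_; proj₁; proj₂)
open import Data.Sum using (inj₁; inj₂)
open import Relation.Binary.PropositionalEquality
open import Relation.Nullary using (Dec; yes; no; does; ¬_)
open import Relation.Nullary.Negation using (contradiction)
open import Relation.Nullary.Decidable using (dec-true; dec-false)
open import Algebra.Properties.Semiring.Sum +-*-semiring
  using (sum; sum-cong-≗; sum-remove; sum-replicate-zero; ∑-comm; ∑-distrib-+; *-distribˡ-sum)

bit : Bool → ℕ
bit true  = 1
bit false = 0

count : ∀ {n} → Vector Bool n → ℕ
count v = sum (λ i → bit (v i))

sum-split : ∀ m {n} (f : Fin (m + n) → ℕ) →
  sum f ≡ sum (λ i → f (i ↑ˡ n)) + sum (λ j → f (m ↑ʳ j))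
sum-split zero    f = refl
sum-split (suc m) f = trans (cong (f zero +_) (sum-split m (λ i → f (suc i))))
                            (sym (+-assoc (f zero) _ _))

sum-combine : ∀ m {n} (f : Fin (m * n) → ℕ) →
  sum f ≡ sum (λ i → sum (λ j → f (combine {m} {n} i j)))
sum-combine zero        f = refl
sum-combine (suc m) {n} f = trans (sum-split n f)
  (cong (sum (λ j → f (j ↑ˡ m * n)) +_) (sum-combine m (λ k → f (n ↑ʳ k))))

count-++ : ∀ {m n} (u : Vector Bool m) (v : Vector Bool n) → count (u ++ v) ≡ count u + count v
count-++ {m} u v = trans (sum-split m (λ k → bit ((u ++ v) k)))
  (cong₂ _+_ (sum-cong-≗ (λ i → cong bit (lookup-++ˡ u v i)))
             (sum-cong-≗ (λ j → cong bit (lookup-++ʳ u v j))))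

count-insertAt : ∀ {n} (v : Vector Bool n) i b → count (insertAt v i b) ≡ bit b + count v
count-insertAt v i b = trans (sum-remove {i = i} (λ k → bit (insertAt v i b k)))
  (cong₂ _+_ (cong bit (insertAt-lookup v i b))
             (sum-cong-≗ (λ j → cong bit (insertAt-punchIn v i b j))))

count-true : ∀ n → count {n} (λ _ → true) ≡ n
count-true zero    = refl
count-true (suc n) = cong suc (count-true n)

count-complement : ∀ {n} (v : Vector Bool n) → count v + count (λ i → not (v i)) ≡ n
count-complement {zero}  v = refl
count-complement {suc n} v with v zero
... | true  = cong suc (count-complement (λ i → v (suc i)))
... | false = trans (+-suc _ _) (cong suc (count-complement (λ i → v (suc i))))

count-delta : ∀ {n} (c : Vector Bool n) (i₀ : Fin n) → count (λ i → c i ∧ does (i ≟ i₀)) ≡ bit (c i₀)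
count-delta {suc n} c zero = trans
  (cong₂ _+_ (cong bit (∧-identityʳ (c zero)))
             (trans (sum-cong-≗ (λ i → cong bit (∧-zeroʳ (c (suc i))))) (sum-replicate-zero n)))
  (+-identityʳ (bit (c zero)))
count-delta {suc n} c (suc i₀) = trans
  (cong (_+ count (λ i → c (suc i) ∧ does (i ≟ i₀))) (cong bit (∧-zeroʳ (c zero))))
  (count-delta (λ i → c (suc i)) i₀)

true-entry : ∀ {n} (v : Vector Bool n) → ¬ count v ≡ 0 → Σ (Fin n) (λ i → v i ≡ true)
true-entry {zero}  v c≢0 = contradiction refl c≢0
true-entry {suc n} v c≢0 with v zero in v₀
... | true  = zero , v₀
... | false = let (i , vi) = true-entry (λ i → v (suc i)) c≢0 in suc i , vi

false-entry : ∀ {n} (v : Vector Bool n) → count v < n → Σ (Fin n) (λ i → v i ≡ false)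
false-entry {suc n} v c<n with v zero in v₀
... | false = zero , v₀
... | true  = let (i , vi) = false-entry (λ i → v (suc i)) (≤-pred c<n) in suc i , vi

length-filter-tabulate : ∀ {A : Set} {P : A → Set} (P? : ∀ x → Dec (P x)) {n} (g : Fin n → A) →
  length (filter P? (tabulate g)) ≡ count (λ i → does (P? (g i)))
length-filter-tabulate P? {zero}  g = refl
length-filter-tabulate P? {suc n} g with does (P? (g zero))
... | true  = cong suc (length-filter-tabulate P? (λ i → g (suc i)))
... | false = length-filter-tabulate P? (λ i → g (suc i))

sum-tabulate : ∀ {n} (f : Fin n → ℕ) → List.sum (tabulate f) ≡ sum f
sum-tabulate {zero}  f = refl
sum-tabulate {suc n} f = cong (f zero +_) (sum-tabulate (λ i → f (suc i)))

∣-all-but-one : ∀ d {n} (f : Fin n → ℕ) (i₀ : Fin n) → d ∣ sum f →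
  (∀ i → ¬ i ≡ i₀ → d ∣ f i) → d ∣ f i₀
∣-all-but-one d {suc n} f i₀ d∣Σ d∣others =
  ∣m+n∣m⇒∣n (subst (d ∣_) (trans (sum-remove {i = i₀} f) (+-comm (f i₀) _)) d∣Σ)
            (∣-sum (λ i → f (punchIn i₀ i)) (λ i → d∣others (punchIn i₀ i) (punchInᵢ≢i i₀ i)))
  where
  ∣-sum : ∀ {k} (g : Fin k → ℕ) → (∀ i → d ∣ g i) → d ∣ sum g
  ∣-sum {zero}  g d∣g = divides 0 refl
  ∣-sum {suc k} g d∣g = ∣m∣n⇒∣m+n (d∣g zero) (∣-sum (λ i → g (suc i)) (λ i → d∣g (suc i)))

does-sym : ∀ {n} (x y : Fin n) → does (x ≟ y) ≡ does (y ≟ x)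
does-sym x y with x ≟ y
... | yes x≡y = sym (dec-true (y ≟ x) (sym x≡y))
... | no  x≢y = sym (dec-false (y ≟ x) (λ y≡x → x≢y (sym y≡x)))

does-injective : ∀ {a b} (f : Fin a → Fin b) → (∀ {x y} → f x ≡ f y → x ≡ y) →
  ∀ x y → does (f x ≟ f y) ≡ does (x ≟ y)
does-injective f f-inj x y with x ≟ y
... | yes refl = dec-true (f x ≟ f x) refl
... | no  x≢y  = dec-false (f x ≟ f y) (λ fx≡fy → x≢y (f-inj fx≡fy))

three-times : ∀ x → x + 2 * x ≡ x * 3
three-times = solve-∀

module _ (G : Graph) where

  reverse : Orientation G → Orientation G
  reverse D e = not (D e)

  -- The tail of an edge, without the with-abstraction of its definition.
  tail-if : ∀ D e → tail G D e ≡ (if D e then proj₁ (ends G e) else proj₂ (ends G e))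
  tail-if D e with D e
  ... | true  = refl
  ... | false = refl

  head-reverse : ∀ D e → head G D e ≡ tail G (reverse D) e
  head-reverse D e with D e
  ... | true  = refl
  ... | false = refl

  outdeg-count : ∀ D v → outdeg G D v ≡ count (λ e → does (tail G D e ≟ v))
  outdeg-count D v = length-filter-tabulate (λ e → tail G D e ≟ v) (λ e → e)

  indeg-reverse : ∀ D v → indeg G D v ≡ outdeg G (reverse D) v
  indeg-reverse D v = trans (length-filter-tabulate (λ e → head G D e ≟ v) (λ e → e))
    (trans (sum-cong-≗ (λ e → cong (λ t → bit (does (t ≟ v))) (head-reverse D e)))
           (sym (outdeg-count (reverse D) v)))

  -- Handshake: every edge has exactly one tail and exactly one head.
  sum-outdeg : ∀ D → sum (outdeg G D) ≡ E G
  sum-outdeg D = begin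
    sum (outdeg G D)                                     ≡⟨ sum-cong-≗ (outdeg-count D) ⟩
    sum (λ v → sum (λ e → bit (does (tail G D e ≟ v))))  ≡⟨ ∑-comm (λ v e → bit (does (tail G D e ≟ v))) ⟩
    sum (λ e → count (λ v → does (tail G D e ≟ v)))      ≡⟨ sum-cong-≗ one-tail ⟩
    count {E G} (λ _ → true)                             ≡⟨ count-true (E G) ⟩
    E G                                                  ∎
    where
    open ≡-Reasoning
    one-tail : ∀ e → count (λ v → does (tail G D e ≟ v)) ≡ 1
    one-tail e = trans (sum-cong-≗ (λ v → cong bit (does-sym (tail G D e) v)))
                       (count-delta (λ _ → true) (tail G D e))

  sum-indeg : ∀ D → sum (indeg G D) ≡ E G
  sum-indeg D = trans (sum-cong-≗ (indeg-reverse D)) (sum-outdeg (reverse D))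

-- The β-condition d⁺ - d⁻ ≡ β (mod 3) at a vertex, stated over ℕ as
-- 3 ∣ d⁺ + 2 d⁻ + 2 β.
Balanced : (G : Graph) → (Fin (V G) → ℤ₃) → Orientation G → Fin (V G) → Set
Balanced G β D v = 3 ∣ outdeg G D v + 2 * indeg G D v + 2 * toℕ (β v)

-- The ℕ form of the β-condition implies the form over ℤ used in IsβOrientation,
-- since (o - i) - b = (o + 2 i + 2 b) - 3 (i + b).
balanced⇒congruent : ∀ o i b → 3 ∣ o + 2 * i + 2 * b → ℤ.+ 3 ∣ℤ (o ⊖ i) -ℤ ℤ.+ b
balanced⇒congruent o i b 3∣ = ∣⇒∣ᵤ (subst (ℤ.+ 3 ∣ˢ_) (sym difference)
    (∣m∣n⇒∣m-n (∣ᵤ⇒∣ {i = ℤ.+ (o + 2 * i + 2 * b)} 3∣) (∣m⇒∣m*n (ℤ.+ (i + b)) ∣ˢ-refl)))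
  where
  open ≡-Reasoning
  ring : ∀ O I B → (O -ℤ I) -ℤ B ≡ (O +ℤ ℤ.+ 2 *ℤ I +ℤ ℤ.+ 2 *ℤ B) -ℤ ℤ.+ 3 *ℤ (I +ℤ B)
  ring = ℤ-solve-∀
  embed : ℤ.+ (o + 2 * i + 2 * b) ≡ ℤ.+ o +ℤ ℤ.+ 2 *ℤ ℤ.+ i +ℤ ℤ.+ 2 *ℤ ℤ.+ b
  embed = begin
    ℤ.+ (o + 2 * i + 2 * b)                     ≡⟨ pos-+ (o + 2 * i) (2 * b) ⟩
    ℤ.+ (o + 2 * i) +ℤ ℤ.+ (2 * b)              ≡⟨ cong₂ _+ℤ_ (pos-+ o (2 * i)) (pos-* 2 b) ⟩
    ℤ.+ o +ℤ ℤ.+ (2 * i) +ℤ ℤ.+ 2 *ℤ ℤ.+ b      ≡⟨ cong (λ x → ℤ.+ o +ℤ x +ℤ ℤ.+ 2 *ℤ ℤ.+ b) (pos-* 2 i) ⟩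
    ℤ.+ o +ℤ ℤ.+ 2 *ℤ ℤ.+ i +ℤ ℤ.+ 2 *ℤ ℤ.+ b  ∎
  difference : (o ⊖ i) -ℤ ℤ.+ b ≡ ℤ.+ (o + 2 * i + 2 * b) -ℤ ℤ.+ 3 *ℤ ℤ.+ (i + b)
  difference = begin
    (o ⊖ i) -ℤ ℤ.+ b
      ≡⟨ cong (_-ℤ ℤ.+ b) (sym (m-n≡m⊖n o i)) ⟩
    (ℤ.+ o -ℤ ℤ.+ i) -ℤ ℤ.+ b
      ≡⟨ ring (ℤ.+ o) (ℤ.+ i) (ℤ.+ b) ⟩
    (ℤ.+ o +ℤ ℤ.+ 2 *ℤ ℤ.+ i +ℤ ℤ.+ 2 *ℤ ℤ.+ b) -ℤ ℤ.+ 3 *ℤ (ℤ.+ i +ℤ ℤ.+ b)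
      ≡⟨ cong₂ (λ x y → x -ℤ ℤ.+ 3 *ℤ y) (sym embed) (sym (pos-+ i b)) ⟩
    ℤ.+ (o + 2 * i + 2 * b) -ℤ ℤ.+ 3 *ℤ ℤ.+ (i + b) ∎

-- The two ways the gadget meets the β-condition at a vertex of degree d: by
-- prescribing its out-degree, or its in-degree, modulo 3.
balanced-from-out : ∀ {o i d} b → o + i ≡ d → 3 ∣ d + o + b → 3 ∣ o + 2 * i + 2 * b
balanced-from-out {o} {i} b refl 3∣ =
  ∣m+n∣m⇒∣n (subst (3 ∣_) (twice o i b) (∣n⇒∣m*n 2 3∣)) (n∣m*n o)
  where
  twice : ∀ o i b → 2 * (o + i + o + b) ≡ o * 3 + (o + 2 * i + 2 * b)
  twice = solve-∀

balanced-from-in : ∀ {o i d} b → o + i ≡ d → 3 ∣ d + i + 2 * b → 3 ∣ o + 2 * i + 2 * b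
balanced-from-in {o} {i} b refl = subst (3 ∣_) (regroup o i b)
  where
  regroup : ∀ o i b → o + i + i + 2 * b ≡ o + 2 * i + 2 * b
  regroup = solve-∀

module _ (G : Graph) (β : Fin (V G) → ℤ₃) (D : Orientation G) where

  -- Summed over all vertices the balance terms give 3 E + 2 Σ β, a multiple
  -- of 3 when β is a zero-sum function.
  sum-balance-terms : ZeroSum G β → 3 ∣ sum (λ v → outdeg G D v + 2 * indeg G D v + 2 * toℕ (β v))
  sum-balance-terms zero-sum = subst (3 ∣_) (sym total)
      (∣m∣n⇒∣m+n (divides (E G) (three-times (E G))) (∣n⇒∣m*n 2 3∣Σβ))
    where
    open ≡-Reasoning
    Σβ : ℕ
    Σβ = sum (λ v → toℕ (β v))
    3∣Σβ : 3 ∣ Σβ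
    3∣Σβ = subst (3 ∣_) (trans (cong List.sum (map-tabulate (λ v → v) (λ v → toℕ (β v))))
                               (sum-tabulate (λ v → toℕ (β v)))) zero-sum
    total : sum (λ v → outdeg G D v + 2 * indeg G D v + 2 * toℕ (β v)) ≡ E G + 2 * E G + 2 * Σβ
    total = begin
      sum (λ v → outdeg G D v + 2 * indeg G D v + 2 * toℕ (β v))
        ≡⟨ ∑-distrib-+ (λ v → outdeg G D v + 2 * indeg G D v) (λ v → 2 * toℕ (β v)) ⟩
      sum (λ v → outdeg G D v + 2 * indeg G D v) + sum (λ v → 2 * toℕ (β v))
        ≡⟨ cong₂ _+_ (∑-distrib-+ (outdeg G D) (λ v → 2 * indeg G D v))
                     (sym (*-distribˡ-sum 2 (λ v → toℕ (β v)))) ⟩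
      sum (outdeg G D) + sum (λ v → 2 * indeg G D v) + 2 * Σβ
        ≡⟨ cong (λ x → sum (outdeg G D) + x + 2 * Σβ) (sym (*-distribˡ-sum 2 (indeg G D))) ⟩
      sum (outdeg G D) + 2 * sum (indeg G D) + 2 * Σβ
        ≡⟨ cong₂ (λ x y → x + 2 * y + 2 * Σβ) (sum-outdeg G D) (sum-indeg G D) ⟩
      E G + 2 * E G + 2 * Σβ ∎

  all-but-one-balanced : ZeroSum G β → (v₀ : Fin (V G)) →
    (∀ v → ¬ v ≡ v₀ → Balanced G β D v) → IsβOrientation G β D
  all-but-one-balanced zero-sum v₀ balanced v =
    balanced⇒congruent (outdeg G D v) (indeg G D v) (toℕ (β v)) (balanced-everywhere v)
    where
    balanced-everywhere : ∀ v → Balanced G β D v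
    balanced-everywhere v with v ≟ v₀
    ... | no  v≢v₀ = balanced v v≢v₀
    ... | yes refl = ∣-all-but-one 3 (λ u → outdeg G D u + 2 * indeg G D u + 2 * toℕ (β u)) v₀
                       (sum-balance-terms zero-sum) balanced

Reach-trans : ∀ {G D u v w} → Reach G D u v → Reach G D v w → Reach G D u w
Reach-trans here              r = r
Reach-trans (step e tail≡ r₁) r = step e tail≡ (Reach-trans r₁ r)

edge-reach : ∀ G D e → Reach G D (tail G D e) (head G D e)
edge-reach G D e = step e refl here

hub-strongly-connected : ∀ {G D} h → (∀ v → Reach G D v h) → (∀ v → Reach G D h v) → StronglyConnected G D
hub-strongly-connected h to-h from-h u v = Reach-trans (to-h u) (from-h v)

unary : ℤ₃ → Vector Bool 2
unary 0F = false ∷ false ∷ []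
unary 1F = true  ∷ false ∷ []
unary 2F = true  ∷ true  ∷ []

count-unary : ∀ x → count (unary x) ≡ toℕ x
count-unary 0F = refl
count-unary 1F = refl
count-unary 2F = refl

complete : ℕ → ℤ₃
complete x = DivMod.remainder (2 * x divMod 3)

complete-spec : ∀ x → 3 ∣ x + toℕ (complete x)
complete-spec x = ∣m+n∣m⇒∣n (divides x (begin
    q * 3 + (x + r)  ≡⟨ rearrange x r q ⟩
    x + (r + q * 3)  ≡⟨ cong (x +_) (sym (DivMod.property (2 * x divMod 3))) ⟩
    x + 2 * x        ≡⟨ three-times x ⟩
    x * 3            ∎)) (n∣m*n q)
  where
  open ≡-Reasoning
  q r : ℕ
  q = DivMod.quotient (2 * x divMod 3)
  r = toℕ (complete x)
  rearrange : ∀ x r q → q * 3 + (x + r) ≡ x + (r + q * 3)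
  rearrange = solve-∀

slot-digit : ∀ {a b} → Vector Bool a → Vector Bool b → ℕ → ℤ₃
slot-digit {a} {b} pre rest t = complete (a + (2 + b) + (count pre + count rest) + t)

slotted : ∀ {a b} → Vector Bool a → Vector Bool b → ℕ → Vector Bool (a + (2 + b))
slotted pre rest t = pre ++ (unary (slot-digit pre rest t) ++ rest)

slotted-balanced : ∀ {a b} (pre : Vector Bool a) (rest : Vector Bool b) t →
  3 ∣ a + (2 + b) + count (slotted pre rest t) + t
slotted-balanced {a} {b} pre rest t = subst (3 ∣_) (sym (begin
    L + count (slotted pre rest t) + t
      ≡⟨ cong (λ c → L + c + t) (trans (count-++ pre _) (cong (count pre +_) (count-++ (unary d) rest))) ⟩
    L + (count pre + (count (unary d) + count rest)) + t
      ≡⟨ cong (λ x → L + (count pre + (x + count rest)) + t) (count-unary d) ⟩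
    L + (count pre + (toℕ d + count rest)) + t
      ≡⟨ regroup L (count pre) (toℕ d) (count rest) t ⟩
    L + (count pre + count rest) + t + toℕ d ∎))
  (complete-spec (L + (count pre + count rest) + t))
  where
  open ≡-Reasoning
  L : ℕ
  L = a + (2 + b)
  d : ℤ₃
  d = slot-digit pre rest t
  regroup : ∀ L P x R t → L + (P + (x + R)) + t ≡ L + (P + R) + t + x
  regroup = solve-∀

core-column : Fin 3 → Fin 4 → Bool → ℤ₃ → Vector Bool 4
core-column i k a x = insertAt (insertAt (unary x) i a) k (not a)

count-core-column : ∀ i k a x → count (core-column i k a x) ≡ suc (toℕ x)
count-core-column i k a x = begin
  count (core-column i k a x)
    ≡⟨ count-insertAt (insertAt (unary x) i a) k (not a) ⟩
  bit (not a) + count (insertAt (unary x) i a)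
    ≡⟨ cong (bit (not a) +_) (trans (count-insertAt (unary x) i a) (cong (bit a +_) (count-unary x))) ⟩
  bit (not a) + (bit a + toℕ x)
    ≡⟨ pair a ⟩
  suc (toℕ x) ∎
  where
  open ≡-Reasoning
  pair : ∀ a → bit (not a) + (bit a + toℕ x) ≡ suc (toℕ x)
  pair true  = refl
  pair false = refl

module Bipartite (m n : ℕ) where

  row : Fin m → Fin (m + n)
  row i = i ↑ˡ n

  col : Fin n → Fin (m + n)
  col j = m ↑ʳ j

  data RowOrCol : Fin (m + n) → Set where
    is-row : ∀ i → RowOrCol (row i)
    is-col : ∀ j → RowOrCol (col j)

  row-or-col : ∀ v → RowOrCol v
  row-or-col v with splitAt m v in split≡
  ... | inj₁ i = subst RowOrCol (trans (cong (join m n) (sym split≡)) (join-splitAt m n v)) (is-row i)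
  ... | inj₂ j = subst RowOrCol (trans (cong (join m n) (sym split≡)) (join-splitAt m n v)) (is-col j)

  col≢row : ∀ j i → ¬ col j ≡ row i
  col≢row j i col≡row with trans (sym (splitAt-↑ʳ m n j)) (trans (cong (splitAt m) col≡row) (splitAt-↑ˡ m i n))
  ... | ()

  orientation : (Fin m → Fin n → Bool) → Orientation (K m n)
  orientation X e = X (proj₁ (remQuot {m} n e)) (proj₂ (remQuot {m} n e))

  flip : (Fin m → Fin n → Bool) → Fin m → Fin n → Bool
  flip X i j = not (X i j)

  tail-combine : ∀ X i j → tail (K m n) (orientation X) (combine i j) ≡ (if X i j then row i else col j)
  tail-combine X i j = trans (tail-if (K m n) (orientation X) (combine i j))
    (cong (λ ij → if X (proj₁ ij) (proj₂ ij) then row (proj₁ ij) else col (proj₂ ij))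
          (remQuot-combine i j))

  head-combine : ∀ X i j → head (K m n) (orientation X) (combine i j) ≡ (if not (X i j) then row i else col j)
  head-combine X i j = trans (head-reverse (K m n) (orientation X) (combine i j)) (tail-combine (flip X) i j)

  edge-out : ∀ {X i j} → X i j ≡ true → Reach (K m n) (orientation X) (row i) (col j)
  edge-out {X} {i} {j} Xij = subst₂ (Reach (K m n) (orientation X))
    (trans (tail-combine X i j) (cong (λ b → if b then row i else col j) Xij))
    (trans (head-combine X i j) (cong (λ b → if not b then row i else col j) Xij))
    (edge-reach (K m n) (orientation X) (combine i j))

  edge-in : ∀ {X i j} → X i j ≡ false → Reach (K m n) (orientation X) (col j) (row i)
  edge-in {X} {i} {j} Xij = subst₂ (Reach (K m n) (orientation X))
    (trans (tail-combine X i j) (cong (λ b → if b then row i else col j) Xij))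
    (trans (head-combine X i j) (cong (λ b → if not b then row i else col j) Xij))
    (edge-reach (K m n) (orientation X) (combine i j))

  tail-at-row : ∀ X i j i₀ → does (tail (K m n) (orientation X) (combine i j) ≟ row i₀) ≡ X i j ∧ does (i ≟ i₀)
  tail-at-row X i j i₀ = trans (cong (λ t → does (t ≟ row i₀)) (tail-combine X i j)) (by-cases (X i j))
    where
    by-cases : ∀ b → does ((if b then row i else col j) ≟ row i₀) ≡ b ∧ does (i ≟ i₀)
    by-cases true  = does-injective row (↑ˡ-injective n _ _) i i₀
    by-cases false = dec-false (col j ≟ row i₀) (col≢row j i₀)

  tail-at-col : ∀ X i j j₀ → does (tail (K m n) (orientation X) (combine i j) ≟ col j₀) ≡ not (X i j) ∧ does (j ≟ j₀)
  tail-at-col X i j j₀ = trans (cong (λ t → does (t ≟ col j₀)) (tail-combine X i j)) (by-cases (X i j))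
    where
    by-cases : ∀ b → does ((if b then row i else col j) ≟ col j₀) ≡ not b ∧ does (j ≟ j₀)
    by-cases true  = dec-false (row i ≟ col j₀) (λ row≡col → col≢row j₀ i (sym row≡col))
    by-cases false = does-injective col (↑ʳ-injective m _ _) j j₀

  outdeg-row : ∀ X i₀ → outdeg (K m n) (orientation X) (row i₀) ≡ count (X i₀)
  outdeg-row X i₀ = begin
    outdeg (K m n) (orientation X) (row i₀)
      ≡⟨ outdeg-count (K m n) (orientation X) (row i₀) ⟩
    count (λ e → does (tail (K m n) (orientation X) e ≟ row i₀))
      ≡⟨ sum-combine m _ ⟩
    sum {m} (λ i → sum {n} (λ j → bit (does (tail (K m n) (orientation X) (combine i j) ≟ row i₀))))
      ≡⟨ sum-cong-≗ (λ i → sum-cong-≗ (λ j → cong bit (tail-at-row X i j i₀))) ⟩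
    sum (λ i → sum (λ j → bit (X i j ∧ does (i ≟ i₀))))
      ≡⟨ ∑-comm (λ i j → bit (X i j ∧ does (i ≟ i₀))) ⟩
    sum (λ j → count (λ i → X i j ∧ does (i ≟ i₀)))
      ≡⟨ sum-cong-≗ (λ j → count-delta (λ i → X i j) i₀) ⟩
    count (X i₀) ∎
    where open ≡-Reasoning

  outdeg-col : ∀ X j₀ → outdeg (K m n) (orientation X) (col j₀) ≡ count (λ i → not (X i j₀))
  outdeg-col X j₀ = begin
    outdeg (K m n) (orientation X) (col j₀)
      ≡⟨ outdeg-count (K m n) (orientation X) (col j₀) ⟩
    count (λ e → does (tail (K m n) (orientation X) e ≟ col j₀))
      ≡⟨ sum-combine m _ ⟩
    sum {m} (λ i → sum {n} (λ j → bit (does (tail (K m n) (orientation X) (combine i j) ≟ col j₀))))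
      ≡⟨ sum-cong-≗ (λ i → sum-cong-≗ (λ j → cong bit (tail-at-col X i j j₀))) ⟩
    sum (λ i → count (λ j → not (X i j) ∧ does (j ≟ j₀)))
      ≡⟨ sum-cong-≗ (λ i → count-delta (λ j → not (X i j)) j₀) ⟩
    count (λ i → not (X i j₀)) ∎
    where open ≡-Reasoning

  indeg-row : ∀ X i → indeg (K m n) (orientation X) (row i) ≡ count (λ j → not (X i j))
  indeg-row X i = trans (indeg-reverse (K m n) (orientation X) (row i)) (outdeg-row (flip X) i)

  indeg-col : ∀ X j → indeg (K m n) (orientation X) (col j) ≡ count (λ i → X i j)
  indeg-col X j = trans (indeg-reverse (K m n) (orientation X) (col j))
    (trans (outdeg-col (flip X) j) (sum-cong-≗ (λ i → cong bit (not-involutive (X i j)))))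

  row-balanced : ∀ X β i → 3 ∣ n + count (X i) + toℕ (β (row i)) →
    Balanced (K m n) β (orientation X) (row i)
  row-balanced X β i 3∣ = balanced-from-out (toℕ (β (row i)))
    (trans (cong₂ _+_ (outdeg-row X i) (indeg-row X i)) (count-complement (X i)))
    (subst (λ d⁺ → 3 ∣ n + d⁺ + toℕ (β (row i))) (sym (outdeg-row X i)) 3∣)

  col-balanced : ∀ X β j → 3 ∣ m + count (λ i → X i j) + 2 * toℕ (β (col j)) →
    Balanced (K m n) β (orientation X) (col j)
  col-balanced X β j 3∣ = balanced-from-in (toℕ (β (col j)))
    (trans (cong₂ _+_ (outdeg-col X j) (indeg-col X j))
           (trans (+-comm _ (count (λ i → X i j))) (count-complement (λ i → X i j))))
    (subst (λ d⁻ → 3 ∣ m + d⁻ + 2 * toℕ (β (col j))) (sym (indeg-col X j)) 3∣)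

module Gadget (p q : ℕ) (β : Fin (4 + p + (10 + q)) → ℤ₃) where

  M N : ℕ
  M = 4 + p
  N = 10 + q

  open Bipartite M N

  rowTarget : Fin M → ℕ
  rowTarget i = toℕ (β (row i))

  colTarget : Fin N → ℕ
  colTarget j = 2 * toℕ (β (col j))

  -- Row 4 + i: a slot balancing the row, then false (column 2), then trues.
  genericRest : Vector Bool (8 + q)
  genericRest = false ∷ λ _ → true

  generic : Fin p → Vector Bool N
  generic i = slotted [] genericRest (rowTarget (4 ↑ʳ i))

  -- The core rows contribute 1 + e j trues to column j; e j balances the column.
  e : Fin N → ℤ₃
  e j = complete (M + suc (count (λ i → generic i j)) + colTarget j)

  e≥1 e≥2 : Fin N → Bool
  e≥1 j = unary (e j) 0F
  e≥2 j = unary (e j) 1F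

  -- Columns 0–5 hold their slots, column 6 + t carries
  -- the cycle edge from core row t to core row t + 1 (mod 4), columns 10+
  -- point from row 0 to row 3, and every other core entry of column j is one
  -- of the bits e≥1 j, e≥2 j.
  pre₁ : Vector Bool 0
  pre₁ = []
  rest₁ : Vector Bool (8 + q)
  rest₁ = e≥1 2F ∷ e≥1 3F ∷ e≥1 4F ∷ e≥1 5F ∷ false ∷ true ∷ e≥2 8F ∷ e≥1 9F ∷ λ k → e≥1 (10 ↑ʳ k)
  pre₂ : Vector Bool 2
  pre₂ = e≥1 0F ∷ e≥1 1F ∷ []
  rest₂ : Vector Bool (6 + q)
  rest₂ = e≥2 4F ∷ e≥2 5F ∷ e≥1 6F ∷ false ∷ true ∷ e≥2 9F ∷ λ k → e≥2 (10 ↑ʳ k)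
  pre₃ : Vector Bool 4
  pre₃ = e≥2 0F ∷ e≥2 1F ∷ e≥2 2F ∷ e≥2 3F ∷ []
  rest₃ : Vector Bool (4 + q)
  rest₃ = e≥2 6F ∷ e≥2 7F ∷ false ∷ true ∷ λ _ → false

  d₁ d₂ d₃ : ℤ₃
  d₁ = slot-digit pre₁ rest₁ (rowTarget 1F)
  d₂ = slot-digit pre₂ rest₂ (rowTarget 2F)
  d₃ = slot-digit pre₃ rest₃ (rowTarget 3F)

  -- Row 0 complements the slots, so that they do not affect column counts.
  complemented : ℤ₃ → Vector Bool 2
  complemented d k = not (unary d k)

  row₀ : Vector Bool N
  row₀ = complemented d₁ ++ (complemented d₂ ++ (complemented d₃ ++ (true ∷ e≥1 7F ∷ e≥1 8F ∷ false ∷ λ _ → true)))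

  X : Fin M → Fin N → Bool
  X 0F = row₀
  X 1F = slotted pre₁ rest₁ (rowTarget 1F)
  X 2F = slotted pre₂ rest₂ (rowTarget 2F)
  X 3F = slotted pre₃ rest₃ (rowTarget 3F)
  X (suc (suc (suc (suc i)))) = generic i

  D : Orientation (K M N)
  D = orientation X

  core : Fin 4 → Fin M
  core t = t ↑ˡ p

  core-count : ∀ j → count (λ t → X (core t) j) ≡ suc (toℕ (e j))
  core-count 0F = count-core-column 0F 0F (unary d₁ 0F) (e 0F)
  core-count 1F = count-core-column 0F 0F (unary d₁ 1F) (e 1F)
  core-count 2F = count-core-column 1F 0F (unary d₂ 0F) (e 2F)
  core-count 3F = count-core-column 1F 0F (unary d₂ 1F) (e 3F)
  core-count 4F = count-core-column 2F 0F (unary d₃ 0F) (e 4F)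
  core-count 5F = count-core-column 2F 0F (unary d₃ 1F) (e 5F)
  core-count 6F = count-core-column 0F 0F false (e 6F)
  core-count 7F = count-core-column 1F 1F false (e 7F)
  core-count 8F = count-core-column 2F 2F false (e 8F)
  core-count 9F = count-core-column 2F 0F true (e 9F)
  core-count j@(suc (suc (suc (suc (suc (suc (suc (suc (suc (suc _)))))))))) =
    count-core-column 2F 0F false (e j)

  column-count : ∀ j → count (λ i → X i j) ≡ suc (count (λ i → generic i j)) + toℕ (e j)
  column-count j = begin
    count (λ i → X i j)                                     ≡⟨ sum-split 4 (λ i → bit (X i j)) ⟩
    count (λ t → X (core t) j) + count (λ i → generic i j)  ≡⟨ cong (_+ count (λ i → generic i j)) (core-count j) ⟩
    suc (toℕ (e j)) + count (λ i → generic i j)             ≡⟨ cong suc (+-comm (toℕ (e j)) _) ⟩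
    suc (count (λ i → generic i j)) + toℕ (e j)             ∎
    where open ≡-Reasoning

  column-balanced : ∀ j → Balanced (K M N) β D (col j)
  column-balanced j = col-balanced X β j (subst (λ c → 3 ∣ M + c + colTarget j) (sym (column-count j))
    (subst (3 ∣_) (regroup M (suc (count (λ i → generic i j))) (toℕ (e j)) (colTarget j))
           (complete-spec (M + suc (count (λ i → generic i j)) + colTarget j))))
    where
    regroup : ∀ m c x t → m + c + t + x ≡ m + (c + x) + t
    regroup = solve-∀

  hub : Fin (M + N)
  hub = row 0F

  balanced-off-hub : ∀ v → ¬ v ≡ hub → Balanced (K M N) β D v
  balanced-off-hub v = by-view (row-or-col v)
    where
    by-view : ∀ {v} → RowOrCol v → ¬ v ≡ hub → Balanced (K M N) β D v
    by-view (is-row 0F) ≢hub = contradiction refl ≢hub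
    by-view (is-row 1F) _ = row-balanced X β 1F (slotted-balanced pre₁ rest₁ (rowTarget 1F))
    by-view (is-row 2F) _ = row-balanced X β 2F (slotted-balanced pre₂ rest₂ (rowTarget 2F))
    by-view (is-row 3F) _ = row-balanced X β 3F (slotted-balanced pre₃ rest₃ (rowTarget 3F))
    by-view (is-row i@(suc (suc (suc (suc _))))) _ =
      row-balanced X β i (slotted-balanced [] genericRest (rowTarget i))
    by-view (is-col j) _ = column-balanced j

  -- The core rows form the directed cycle 0 → 1 → 2 → 3 → 0 through columns 6–9.
  next : Fin 4 → Fin 4
  next 0F = 1F
  next 1F = 2F
  next 2F = 3F
  next 3F = 0F

  cycle : ∀ t → Reach (K M N) D (row (core t)) (row (core (next t)))
  cycle 0F = Reach-trans (edge-out {X} {0F} {6F} refl) (edge-in {X} {1F} {6F} refl)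
  cycle 1F = Reach-trans (edge-out {X} {1F} {7F} refl) (edge-in {X} {2F} {7F} refl)
  cycle 2F = Reach-trans (edge-out {X} {2F} {8F} refl) (edge-in {X} {3F} {8F} refl)
  cycle 3F = Reach-trans (edge-out {X} {3F} {9F} refl) (edge-in {X} {0F} {9F} refl)

  hub→core : ∀ t → Reach (K M N) D hub (row (core t))
  hub→core 0F = here
  hub→core 1F = cycle 0F
  hub→core 2F = Reach-trans (cycle 0F) (cycle 1F)
  hub→core 3F = Reach-trans (cycle 0F) (Reach-trans (cycle 1F) (cycle 2F))

  core→hub : ∀ t → Reach (K M N) D (row (core t)) hub
  core→hub 0F = here
  core→hub 1F = Reach-trans (cycle 1F) (Reach-trans (cycle 2F) (cycle 3F))
  core→hub 2F = Reach-trans (cycle 2F) (cycle 3F)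
  core→hub 3F = cycle 3F

  -- Column j has 1 + e j ∈ {1, 2, 3} core trues, so a true and a false core entry.
  hub→col : ∀ j → Reach (K M N) D hub (col j)
  hub→col j =
    let (t , Xtj) = true-entry (λ t → X (core t) j) (λ c≡0 → 0≢1+n (trans (sym c≡0) (core-count j)))
    in Reach-trans (hub→core t) (edge-out {X} Xtj)

  col→hub : ∀ j → Reach (K M N) D (col j) hub
  col→hub j =
    let (t , Xtj) = false-entry (λ t → X (core t) j) (subst (_< 4) (sym (core-count j)) (s≤s (toℕ<n (e j))))
    in Reach-trans (edge-in {X} Xtj) (core→hub t)

  -- A generic row is entered from column 2 and left through column 3.
  hub→ : ∀ v → Reach (K M N) D hub v
  hub→ v = by-view (row-or-col v)
    where
    by-view : ∀ {v} → RowOrCol v → Reach (K M N) D hub v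
    by-view (is-row 0F) = hub→core 0F
    by-view (is-row 1F) = hub→core 1F
    by-view (is-row 2F) = hub→core 2F
    by-view (is-row 3F) = hub→core 3F
    by-view (is-row i@(suc (suc (suc (suc _))))) = Reach-trans (hub→col 2F) (edge-in {X} {i} {2F} refl)
    by-view (is-col j) = hub→col j

  →hub : ∀ v → Reach (K M N) D v hub
  →hub v = by-view (row-or-col v)
    where
    by-view : ∀ {v} → RowOrCol v → Reach (K M N) D v hub
    by-view (is-row 0F) = core→hub 0F
    by-view (is-row 1F) = core→hub 1F
    by-view (is-row 2F) = core→hub 2F
    by-view (is-row 3F) = core→hub 3F
    by-view (is-row i@(suc (suc (suc (suc _))))) = Reach-trans (edge-out {X} {i} {3F} refl) (col→hub 3F)
    by-view (is-col j) = col→hub j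

  strongly-connected-β-orientation : ZeroSum (K M N) β →
    Σ (Orientation (K M N)) (λ D → IsβOrientation (K M N) β D × StronglyConnected (K M N) D)
  strongly-connected-β-orientation zero-sum =
    D , all-but-one-balanced (K M N) β D zero-sum hub balanced-off-hub , hub-strongly-connected hub →hub hub→

lemma2p14 : (m n : ℕ) → m ≥ 4 → n ≥ 10 → InS3 (K m n)
lemma2p14 m n m≥4 n≥10 with m≤n⇒∃[o]m+o≡n m≥4 | m≤n⇒∃[o]m+o≡n n≥10
... | p , refl | q , refl = Gadget.strongly-connected-β-orientation p q
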